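{- Let $D$ be a directed graph on the vertex set $[n]=\{1,\dots,n\}$ (loops allowed). Then $q \mapsto \min\{\operatorname{rank}(f) : f \in F[D,q]\}$, defined for integers $q \ge 2$, is a non-increasing function of $q$.
   Context: For an integer $q\ge 2$ let $\langle q\rangle=\{0,1,\dots,q-1\}$. For $f=(f_1,\dots,f_n):\langle q\rangle^n\to\langle q\rangle^n$, the interaction graph $\mathrm{IG}(f)$ is the directed graph on $[n]$ with an arc $uv$ (possibly $u=v$) if and only if there exist $a,b\in\langle q\rangle^n$ that differ only in coordinate $u$ and satisfy $f_v(a)\ne f_v(b)$. $F[D,q]$ is the set of all $f:\langle q\rangle^n\to\langle q\rangle^n$ with $\mathrm{IG}(f)=D$ exactly. The rank of $f$ is $\operatorname{rank}(f)=|\{f(y): y\in\langle q\rangle^n\}|$, the number of images. -}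

module Defs where

open import Data.Nat using (ℕ; zero; suc; _≤_)
open import Data.Fin using (Fin)
open import Data.Fin.Properties using (_≟_)
open import Data.Vec using (Vec; []; _∷_; lookup)
open import Data.Vec.Properties using (≡-dec)
open import Data.List using (List; []; _∷_; map; concatMap; allFin; deduplicate; length)
open import Data.Product using (Σ; ∃; _×_; _,_)
open import Relation.Binary.PropositionalEquality using (_≡_)
open import Relation.Nullary using (¬_)
open import Function.Bundles using (_⇔_)

-- States: ⟨q⟩^n, with ⟨q⟩ = Fin q and coordinates indexed by Fin n (for [n]).
State : ℕ → ℕ → Set
State q n = Vec (Fin q) n

Network : ℕ → ℕ → Set
Network q n = State q n → State q n

Digraph : ℕ → Set₁
Digraph n = Fin n → Fin n → Set

DifferOnlyIn : ∀ {q n} → Fin n → State q n → State q n → Set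
DifferOnlyIn {q} {n} u a b = (w : Fin n) → ¬ (w ≡ u) → lookup a w ≡ lookup b w

IGArc : ∀ {q n} → Network q n → Fin n → Fin n → Set
IGArc {q} {n} f u v =
  Σ (State q n) λ a → Σ (State q n) λ b →
    DifferOnlyIn u a b × ¬ (lookup (f a) v ≡ lookup (f b) v)

InF : ∀ {n} → Digraph n → (q : ℕ) → Network q n → Set
InF {n} D q f = (u v : Fin n) → D u v ⇔ IGArc f u v

allStates : (q n : ℕ) → List (State q n)
allStates q zero = [] ∷ []
allStates q (suc n) = concatMap (λ i → map (i ∷_) (allStates q n)) (allFin q)

rank : ∀ {q n} → Network q n → ℕ
rank {q} {n} f = length (deduplicate (≡-dec _≟_) (map f (allStates q n)))

IsMinRank : ∀ {n} → Digraph n → ℕ → ℕ → Set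
IsMinRank {n} D q m =
  (Σ (Network q n) λ f → InF D q f × rank f ≡ m)
  × ((g : Network q n) → InF D q g → m ≤ rank g)

-- Fin q is a retract of Fin q′: embed it with inject≤ and clamp the values ≥ q back to 0.
-- Conjugating a network f on ⟨q⟩ⁿ by this embedding and retraction gives a network on ⟨q′⟩ⁿ
-- with the same interaction graph whose images all lie in the embedded image set of f, so
-- the minimal rank over ⟨q′⟩ is at most the rank of any network over ⟨q⟩ with that graph.
module Submission where

open import Defs
open import Data.Nat using (ℕ; zero; suc; _≤_; _<_; _<?_; z≤n; s≤s)
open import Data.Nat.Properties using (module ≤-Reasoning)
open import Data.Fin as Fin using (Fin; toℕ; fromℕ<; inject≤)
open import Data.Fin.Properties using (_≟_; toℕ-injective; toℕ-fromℕ<; toℕ-inject≤; toℕ<n)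
import Data.Vec as Vec
open import Data.Vec using (lookup)
open import Data.Vec.Properties using (lookup-map; ≡-dec)
import Data.List as List
open import Data.List using (List; []; _∷_; length; deduplicate)
open import Data.List.Properties using (length-map; length-removeAt′)
open import Data.List.Membership.Propositional using (_∈_)
open import Data.List.Membership.Propositional.Properties
  using (∈-map⁺; ∈-map⁻; ∈-deduplicate⁺; ∈-deduplicate⁻; ∈-allFin)
open import Data.List.Relation.Binary.Subset.Propositional using (_⊆_)
open import Data.List.Relation.Unary.Any using (here; there; index; _─_)
import Data.List.Relation.Unary.Any as Any
open import Data.List.Relation.Unary.Any.Properties using (concatMap⁺)
import Data.List.Relation.Unary.All as All
open import Data.List.Relation.Unary.AllPairs using (_∷_)
open import Data.List.Relation.Unary.Unique.Propositional using (Unique)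
open import Data.List.Relation.Unary.Unique.DecPropositional.Properties using (deduplicate-!)
open import Data.Product using (∃; _,_)
open import Data.Empty using (⊥-elim)
open import Function using (_∘_)
open import Function.Bundles using (mk⇔; Equivalence)
open import Relation.Binary.PropositionalEquality
open import Relation.Nullary using (yes; no)

module _ {A : Set} where

  ∈-─⁺ : ∀ {x y : A} {ys} (x∈ys : x ∈ ys) → y ∈ ys → y ≢ x → y ∈ (ys ─ x∈ys)
  ∈-─⁺ (here refl) (here refl) y≢x = ⊥-elim (y≢x refl)
  ∈-─⁺ (here refl) (there y∈ys) _ = y∈ys
  ∈-─⁺ (there x∈ys) (here refl) _ = here refl
  ∈-─⁺ (there x∈ys) (there y∈ys) y≢x = there (∈-─⁺ x∈ys y∈ys y≢x)

  Unique-⊆⇒length≤ : ∀ {xs ys : List A} → Unique xs → xs ⊆ ys → length xs ≤ length ys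
  Unique-⊆⇒length≤ {[]} _ _ = z≤n
  Unique-⊆⇒length≤ {x ∷ xs} {ys} (x∉xs ∷ unique) xs⊆ys = begin
    suc (length xs)          ≤⟨ s≤s (Unique-⊆⇒length≤ unique xs⊆ys─x∈ys) ⟩
    suc (length (ys ─ x∈ys)) ≡⟨ length-removeAt′ ys (index x∈ys) ⟨
    length ys                ∎
    where
    open ≤-Reasoning
    x∈ys : x ∈ ys
    x∈ys = xs⊆ys (here refl)
    xs⊆ys─x∈ys : xs ⊆ (ys ─ x∈ys)
    xs⊆ys─x∈ys z∈xs = ∈-─⁺ x∈ys (xs⊆ys (there z∈xs)) (All.lookup x∉xs z∈xs ∘ sym)

allStates-complete : ∀ q n (x : State q n) → x ∈ allStates q n
allStates-complete q zero Vec.[] = here refl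
allStates-complete q (suc n) (a Vec.∷ x) =
  concatMap⁺ _ (Any.map (λ { refl → ∈-map⁺ (a Vec.∷_) (allStates-complete q n x) }) (∈-allFin a))

image : ∀ {q n} → Network q n → List (State q n)
image {q} {n} f = deduplicate (≡-dec _≟_) (List.map f (allStates q n))

rank≤-of-factorisation : ∀ {q q′ n} (g : Network q′ n) (f : Network q n)
  (h : State q n → State q′ n) → (∀ x → ∃ λ y → g x ≡ h (f y)) → rank g ≤ rank f
rank≤-of-factorisation {q} {q′} {n} g f h factor = begin
  length (image g)               ≤⟨ Unique-⊆⇒length≤ (deduplicate-! (≡-dec _≟_) _) image-g⊆ ⟩
  length (List.map h (image f))  ≡⟨ length-map h (image f) ⟩
  length (image f)               ∎
  where
  open ≤-Reasoning
  image-g⊆ : image g ⊆ List.map h (image f)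
  image-g⊆ z∈ with ∈-map⁻ g (∈-deduplicate⁻ (≡-dec _≟_) _ z∈)
  ... | x , _ , refl with factor x
  ...   | y , gx≡hfy = subst (_∈ List.map h (image f)) (sym gx≡hfy)
    (∈-map⁺ h (∈-deduplicate⁺ (≡-dec _≟_) (∈-map⁺ f (allStates-complete q n y))))

module _ {q q′ n} (h : Fin q → Fin q′) {x y : State q n} where

  DifferOnlyIn-map : ∀ {u} → DifferOnlyIn u x y → DifferOnlyIn u (Vec.map h x) (Vec.map h y)
  DifferOnlyIn-map x≈y w w≢u = begin
    lookup (Vec.map h x) w  ≡⟨ lookup-map w h x ⟩
    h (lookup x w)          ≡⟨ cong h (x≈y w w≢u) ⟩
    h (lookup y w)          ≡⟨ lookup-map w h y ⟨
    lookup (Vec.map h y) w  ∎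
    where open ≡-Reasoning

  lookup-map-cong : ∀ v → lookup x v ≡ lookup y v → lookup (Vec.map h x) v ≡ lookup (Vec.map h y) v
  lookup-map-cong v xv≡yv = begin
    lookup (Vec.map h x) v  ≡⟨ lookup-map v h x ⟩
    h (lookup x v)          ≡⟨ cong h xv≡yv ⟩
    h (lookup y v)          ≡⟨ lookup-map v h y ⟨
    lookup (Vec.map h y) v  ∎
    where open ≡-Reasoning

module Conjugation {q q′} (emb : Fin q → Fin q′) (prj : Fin q′ → Fin q)
                   (prj∘emb : ∀ a → prj (emb a) ≡ a) where

  E : ∀ {n} → State q n → State q′ n
  E = Vec.map emb

  P : ∀ {n} → State q′ n → State q n
  P = Vec.map prj

  P∘E : ∀ {n} (x : State q n) → P (E x) ≡ x
  P∘E Vec.[] = refl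
  P∘E (a Vec.∷ x) = cong₂ Vec._∷_ (prj∘emb a) (P∘E x)

  conj : ∀ {n} → Network q n → Network q′ n
  conj f = E ∘ f ∘ P

  lookup-E-injective : ∀ {n} {x y : State q n} v → lookup (E x) v ≡ lookup (E y) v → lookup x v ≡ lookup y v
  lookup-E-injective {x = x} {y} v Exv≡Eyv =
    subst₂ (λ x′ y′ → lookup x′ v ≡ lookup y′ v) (P∘E x) (P∘E y) (lookup-map-cong prj {E x} {E y} v Exv≡Eyv)

  IGArc-conj⁺ : ∀ {n} (f : Network q n) {u v} → IGArc f u v → IGArc (conj f) u v
  IGArc-conj⁺ f {u} {v} (x , y , x≈y , fxv≢fyv) = E x , E y , DifferOnlyIn-map emb {x} {y} x≈y , fEx≢fEy
    where
    fEx≢fEy : lookup (conj f (E x)) v ≢ lookup (conj f (E y)) v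
    fEx≢fEy rewrite P∘E x | P∘E y = fxv≢fyv ∘ lookup-E-injective {x = f x} {f y} v

  IGArc-conj⁻ : ∀ {n} (f : Network q n) {u v} → IGArc (conj f) u v → IGArc f u v
  IGArc-conj⁻ f {u} {v} (x , y , x≈y , fxv≢fyv) =
    P x , P y , DifferOnlyIn-map prj {x} {y} x≈y , fxv≢fyv ∘ lookup-map-cong emb {f (P x)} {f (P y)} v

  InF-conj : ∀ {n} (D : Digraph n) (f : Network q n) → InF D q f → InF D q′ (conj f)
  InF-conj D f f∈F u v =
    mk⇔ (IGArc-conj⁺ f ∘ Equivalence.to (f∈F u v)) (Equivalence.from (f∈F u v) ∘ IGArc-conj⁻ f)

  rank-conj : ∀ {n} (f : Network q n) → rank (conj f) ≤ rank f
  rank-conj f = rank≤-of-factorisation (conj f) f E (λ x → P x , refl)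

clamp : ∀ {p q′} → Fin q′ → Fin (suc p)
clamp {p} a with toℕ a <? suc p
... | yes a<q = fromℕ< a<q
... | no _ = Fin.zero

clamp-inject≤ : ∀ {p q′} (q≤q′ : suc p ≤ q′) (a : Fin (suc p)) → clamp (inject≤ a q≤q′) ≡ a
clamp-inject≤ {p} q≤q′ a with toℕ (inject≤ a q≤q′) <? suc p
... | yes a<q = toℕ-injective (trans (toℕ-fromℕ< a<q) (toℕ-inject≤ a q≤q′))
... | no a≮q = ⊥-elim (a≮q (subst (_< suc p) (sym (toℕ-inject≤ a q≤q′)) (toℕ<n a)))

lemma3p1 : (n : ℕ) (D : Digraph n) (q q′ m m′ : ℕ) →
    2 ≤ q → q ≤ q′ →
    IsMinRank D q m → IsMinRank D q′ m′ → m′ ≤ m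
lemma3p1 n D q q′ m m′ (s≤s _) q≤q′ ((f , f∈F , rank-f≡m) , _) (_ , m′-minimal) = begin
  m′             ≤⟨ m′-minimal (conj f) (InF-conj D f f∈F) ⟩
  rank (conj f)  ≤⟨ rank-conj f ⟩
  rank f         ≡⟨ rank-f≡m ⟩
  m              ∎
  where
  open ≤-Reasoning
  open Conjugation (λ a → inject≤ a q≤q′) clamp (clamp-inject≤ q≤q′)
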